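{- Let $r\geq 3$ be an integer and let $G$ be a graph. If $A,B\subseteq V(G)$ induce disjoint cliques with $|A|=r$ and $B=\{u,v\}$ such that $d_A(u,v)\neq 0$, then \[{\rm ext}_G(A,B)\leq (d_A(u)+1)(d_A(v)+1)-\binom{d_A(u,v)+1}{2}.\]
   Context: All graphs are finite and simple. An orientation is $K^\circlearrowright_3$-free if it contains no cyclically oriented triangle. For a graph $G$, $\mathcal{D}(G)$ denotes the set of $K^\circlearrowright_3$-free orientations of $G$. Orientations $\vec S,\vec T$ of disjoint edge sets $S,T\subseteq E(G)$ are compatible if $\vec S\cup\vec T$ is $K^\circlearrowright_3$-free. For disjoint $A,B\subseteq V(G)$, $G[A,B]$ denotes the graph with the edges of $G$ between $A$ and $B$, and with $T=G[A]\cup G[B]$, ${\rm ext}_G(A,B)=\max_{\vec T\in\mathcal{D}(T)}|\{\vec S\in\mathcal{D}(G[A,B])\colon \vec S\text{ and }\vec T\text{ compatible}\}|$. $d_A(x)$ is the number of neighbours of $x$ in $A$, and $d_A(x,y)$ is the number of common neighbours of $x$ and $y$ in $A$. -}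

module Defs where

open import Data.Bool using (Bool; true; false; _∧_; _∨_; not; if_then_else_; _xor_)
open import Data.Nat using (ℕ; zero; suc; _+_; _*_; _∸_; _≤_; _⊔_)
open import Data.Fin using (Fin)
open import Data.List using (List; []; _∷_; map; concatMap; allFin; length)
open import Data.Bool.ListAction using (all; any)
open import Relation.Binary.PropositionalEquality using (_≡_; _≢_)
open import Data.Fin.Properties using (_≟_)
open import Relation.Nullary.Decidable.Core using (does)

record Graph (n : ℕ) : Set where
  field
    adj    : Fin n → Fin n → Bool
    sym    : ∀ x y → adj x y ≡ adj y x
    irrefl : ∀ x → adj x x ≡ false
open Graph public

VSet : ℕ → Set
VSet n = Fin n → Bool

Rel : ℕ → Set
Rel n = Fin n → Fin n → Bool

count : {A : Set} → (A → Bool) → List A → ℕ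
count p []       = 0
count p (x ∷ xs) = (if p x then 1 else 0) + count p xs

allV : {n : ℕ} → (Fin n → Bool) → Bool
allV {n} p = all p (allFin n)

anyV : {n : ℕ} → (Fin n → Bool) → Bool
anyV {n} p = any p (allFin n)

size : {n : ℕ} → VSet n → ℕ
size {n} A = count A (allFin n)

allFuns : {A : Set} → List A → (k : ℕ) → List (Fin k → A)
allFuns xs zero    = (λ ()) ∷ []
allFuns xs (suc k) =
  concatMap (λ a → map (λ f → λ { Fin.zero → a ; (Fin.suc i) → f i }) (allFuns xs k)) xs

allRels : (n : ℕ) → List (Rel n)
allRels n = allFuns (allFuns (true ∷ false ∷ []) n) n

isOrientation : {n : ℕ} → Rel n → Rel n → Bool
isOrientation S D =
  allV λ x → allV λ y →
    (not (D x y) ∨ S x y) ∧ (not (S x y) ∨ (D x y xor D y x))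

k3free : {n : ℕ} → Rel n → Bool
k3free D = not (anyV λ x → anyV λ y → anyV λ z → D x y ∧ D y z ∧ D z x)

inD : {n : ℕ} → Rel n → Rel n → Bool
inD S D = isOrientation S D ∧ k3free D

union : {n : ℕ} → Rel n → Rel n → Rel n
union D E x y = D x y ∨ E x y

compatible : {n : ℕ} → Rel n → Rel n → Bool
compatible D E = k3free (union D E)

insideEdges : {n : ℕ} → Graph n → VSet n → VSet n → Rel n
insideEdges G A B x y = adj G x y ∧ ((A x ∧ A y) ∨ (B x ∧ B y))

betweenEdges : {n : ℕ} → Graph n → VSet n → VSet n → Rel n
betweenEdges G A B x y = adj G x y ∧ ((A x ∧ B y) ∨ (B x ∧ A y))

filterB : {A : Set} → (A → Bool) → List A → List A
filterB p []       = []
filterB p (x ∷ xs) = if p x then x ∷ filterB p xs else filterB p xs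

maxList : List ℕ → ℕ
maxList []       = 0
maxList (x ∷ xs) = x ⊔ maxList xs

nCompat : {n : ℕ} → Graph n → VSet n → VSet n → Rel n → ℕ
nCompat {n} G A B T =
  count (λ S → inD (betweenEdges G A B) S ∧ compatible S T) (allRels n)

ext : {n : ℕ} → Graph n → VSet n → VSet n → ℕ
ext {n} G A B =
  maxList (map (nCompat G A B) (filterB (inD (insideEdges G A B)) (allRels n)))

degIn : {n : ℕ} → Graph n → VSet n → Fin n → ℕ
degIn G A x = count (λ z → A z ∧ adj G x z) (allFin _)

codegIn : {n : ℕ} → Graph n → VSet n → Fin n → Fin n → ℕ
codegIn G A x y = count (λ z → A z ∧ adj G x z ∧ adj G y z) (allFin _)

pair : {n : ℕ} → Fin n → Fin n → VSet n
pair u v x = does (x ≟ u) ∨ does (x ≟ v)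

isClique : {n : ℕ} → Graph n → VSet n → Set
isClique G X = ∀ x y → X x ≡ true → X y ≡ true → x ≢ y → adj G x y ≡ true

module Submission where

-- Fix a K₃-free orientation T⃗ of G[A] ∪ G[B] with B = {u,v}; by
-- symmetry T⃗ has the arc u→v.  Every orientation S⃗ of G[A,B] compatible with
-- T⃗ is recorded by its profile (s,t), the numbers of arcs u→A and v→A in S⃗.
--   * For fixed w ∈ B the out-neighbourhoods of w under two compatible S⃗, S⃗'
--     are nested (T⃗ orients the clique A, and a crossing pair closes a cyclic
--     triangle), so each one is determined by its size; as every edge of
--     G[A,B] is incident with u or v, the profile determines S⃗.
--   * s ≤ d_A(u), and a common neighbour z with v→z forces u→z (else
--     u→v→z→u), whence t ≤ (d_A(v) − c) + min(s,c) where c = d_A(u,v).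
-- So compatible S⃗ inject into a staircase of pairs (s,t) whose size is
--   Σ_{s ≤ d_A(u)} (1 + d_A(v) − c + min(s,c)) = (d_A(u)+1)(d_A(v)+1) − C(c+1,2).

open import Defs hiding (sym)
open import Data.Bool using (Bool; true; false; _∧_; _∨_; not; _xor_)
open import Data.Bool.ListAction using (all; any)
open import Data.Bool.Properties using (∨-zeroʳ; ∧-comm; ∧-assoc)
open import Data.Nat using (ℕ; zero; suc; pred; _+_; _*_; _∸_; _≤_; _<_; _⊓_; z≤n; s≤s)
open import Data.Nat.Properties hiding (_≟_)
open import Algebra.Properties.CommutativeSemigroup +-commutativeSemigroup using (interchange)
open import Data.Nat.Combinatorics using (_C_; nC1≡n; nCk+nC[k+1]≡[n+1]C[k+1])
open import Data.Fin using (Fin)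
open import Data.List using (List; []; _∷_; map; allFin; length; upTo; _++_; concatMap)
open import Data.List.Properties using (length-++; length-map; length-upTo; length-removeAt′)
open import Data.List.Membership.Propositional using (_∈_)
open import Data.List.Membership.Propositional.Properties using (∈-allFin; ∈-upTo⁺; ∈-++⁺ˡ; ∈-++⁺ʳ; ∈-map⁺)
open import Data.List.Relation.Unary.Any using (here; there; _─_; index)
open import Data.List.Relation.Unary.All as All using (All; []; _∷_)
import Data.List.Relation.Unary.All.Properties as All
open import Data.List.Relation.Unary.AllPairs as AllPairs using (AllPairs; []; _∷_)
import Data.List.Relation.Unary.AllPairs.Properties as AllPairs
open import Data.Product using (Σ; _,_; proj₁; proj₂; _×_)
open import Data.Sum using (_⊎_; inj₁; inj₂; swap)
open import Data.Empty using (⊥; ⊥-elim)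
open import Relation.Nullary using (Dec; yes; does)
open import Relation.Nullary.Decidable using (dec-true)
open import Data.Fin.Properties using (_≟_)
open import Relation.Binary.PropositionalEquality
  using (_≡_; _≢_; refl; sym; trans; cong; cong₂; subst; subst₂; module ≡-Reasoning)

∧-intro : ∀ {a b} → a ≡ true → b ≡ true → a ∧ b ≡ true
∧-intro refl refl = refl

∧-true : ∀ a {b} → a ∧ b ≡ true → a ≡ true × b ≡ true
∧-true true p = refl , p

∧₃-true : ∀ a b {c} → a ∧ b ∧ c ≡ true → a ≡ true × b ≡ true × c ≡ true
∧₃-true true true p = refl , refl , p

∨-trueˡ : ∀ {a} b → a ≡ true → a ∨ b ≡ true
∨-trueˡ b refl = refl

∨-trueʳ : ∀ a {b} → b ≡ true → a ∨ b ≡ true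
∨-trueʳ a refl = ∨-zeroʳ a

∨-true : ∀ a {b} → a ∨ b ≡ true → a ≡ true ⊎ b ≡ true
∨-true true  _ = inj₁ refl
∨-true false p = inj₂ p

⇒-true : ∀ a {b} → not a ∨ b ≡ true → a ≡ true → b ≡ true
⇒-true true p refl = p

xor-true : ∀ a {b} → a xor b ≡ true → b ≡ not a
xor-true true  {false} _ = refl
xor-true false {true}  _ = refl

not-true : ∀ {a} → not a ≡ true → a ≡ false
not-true {false} _ = refl

does-true : ∀ {P : Set} (P? : Dec P) → does P? ≡ true → P
does-true (yes p) _ = p

all-true : ∀ {X : Set} (p : X → Bool) xs {x} → all p xs ≡ true → x ∈ xs → p x ≡ true
all-true p (y ∷ ys) h (here refl) = proj₁ (∧-true (p y) h)
all-true p (y ∷ ys) h (there x∈) = all-true p ys (proj₂ (∧-true (p y) h)) x∈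

any-false : ∀ {X : Set} (p : X → Bool) xs {x} → any p xs ≡ false → x ∈ xs → p x ≡ false
any-false p (y ∷ ys) h (here refl) with p y
... | false = refl
any-false p (y ∷ ys) h (there x∈) with p y
... | false = any-false p ys h x∈

allV-true : ∀ {n} (p : Fin n → Bool) → allV p ≡ true → ∀ x → p x ≡ true
allV-true {n} p h x = all-true p (allFin n) h (∈-allFin x)

anyV-false : ∀ {n} (p : Fin n → Bool) → anyV p ≡ false → ∀ x → p x ≡ false
anyV-false {n} p h x = any-false p (allFin n) h (∈-allFin x)

k3free-acyclic : ∀ {n} (D : Rel n) → k3free D ≡ true →
  ∀ x y z → D x y ≡ true → D y z ≡ true → D z x ≡ true → ⊥
k3free-acyclic D free x y z xy yz zx with
  trans (sym (∧-intro xy (∧-intro yz zx)))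
        (anyV-false _ (anyV-false _ (anyV-false _ (not-true free) x) y) z)
... | ()

orientation-at : ∀ {n} (E D : Rel n) → isOrientation E D ≡ true → ∀ x y →
  ((not (D x y) ∨ E x y) ∧ (not (E x y) ∨ (D x y xor D y x))) ≡ true
orientation-at E D h x y = allV-true _ (allV-true _ h x) y

arc-on-edge : ∀ {n} (E D : Rel n) → isOrientation E D ≡ true → ∀ {x y} → D x y ≡ true → E x y ≡ true
arc-on-edge E D h {x} {y} = ⇒-true (D x y) (proj₁ (∧-true _ (orientation-at E D h x y)))

reverse-arc : ∀ {n} (E D : Rel n) → isOrientation E D ≡ true → ∀ {x y} → E x y ≡ true → D y x ≡ not (D x y)
reverse-arc E D h {x} {y} e =
  xor-true (D x y) (⇒-true (E x y) (proj₂ (∧-true (not (D x y) ∨ E x y) (orientation-at E D h x y))) e)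

_⊆ᵇ_ : {X : Set} → (X → Bool) → (X → Bool) → Set
p ⊆ᵇ q = ∀ x → p x ≡ true → q x ≡ true

count-mono : ∀ {X : Set} {p q : X → Bool} → p ⊆ᵇ q → ∀ xs → count p xs ≤ count q xs
count-mono p⊆q [] = z≤n
count-mono {p = p} {q} p⊆q (x ∷ xs) with p x in px | q x in qx
... | true  | true  = s≤s (count-mono p⊆q xs)
... | true  | false with () ← trans (sym (p⊆q x px)) qx
... | false | true  = m≤n⇒m≤1+n (count-mono p⊆q xs)
... | false | false = count-mono p⊆q xs

count-cong : ∀ {X : Set} {p q : X → Bool} → (∀ x → p x ≡ q x) → ∀ xs → count p xs ≡ count q xs
count-cong p≡q [] = refl
count-cong p≡q (x ∷ xs) rewrite p≡q x = cong (_ +_) (count-cong p≡q xs)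

count-split : ∀ {X : Set} (p q : X → Bool) xs →
  count p xs ≡ count (λ x → p x ∧ q x) xs + count (λ x → p x ∧ not (q x)) xs
count-split p q [] = refl
count-split p q (x ∷ xs) with p x | q x
... | false | _     = count-split p q xs
... | true  | true  = cong suc (count-split p q xs)
... | true  | false = trans (cong suc (count-split p q xs)) (sym (+-suc _ _))

count-strict : ∀ {X : Set} {p q : X → Bool} → p ⊆ᵇ q → ∀ xs {y} → y ∈ xs →
  p y ≡ false → q y ≡ true → count p xs < count q xs
count-strict p⊆q (x ∷ xs) (here refl) py qy rewrite py | qy = s≤s (count-mono p⊆q xs)
count-strict {p = p} {q} p⊆q (x ∷ xs) (there y∈) py qy with p x in px | q x in qx
... | true  | true  = s≤s (count-strict p⊆q xs y∈ py qy)
... | true  | false with () ← trans (sym (p⊆q x px)) qx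
... | false | true  = m≤n⇒m≤1+n (count-strict p⊆q xs y∈ py qy)
... | false | false = count-strict p⊆q xs y∈ py qy

-- Two tests cross on a list if some x passes only p and some y passes only q.
-- Non-crossing tests are nested, so equal counts force them to agree.
NonCrossing : {X : Set} → (X → Bool) → (X → Bool) → Set
NonCrossing p q = ∀ x y → p x ≡ true → q x ≡ false → q y ≡ true → p y ≡ false → ⊥

equal-count-agree : ∀ {X : Set} {p q : X → Bool} → NonCrossing p q →
  ∀ xs → count p xs ≡ count q xs → ∀ {x} → x ∈ xs → p x ≡ q x
equal-count-agree {p = p} {q} cross xs same {x} x∈ with p x in px | q x in qx
... | true  | true  = refl
... | false | false = refl
... | true  | false = ⊥-elim (<-irrefl (sym same) (count-strict q⊆p xs x∈ qx px))
  where
  q⊆p : q ⊆ᵇ p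
  q⊆p y qy with p y in py
  ... | true  = refl
  ... | false = ⊥-elim (cross x y px qx qy py)
... | false | true  = ⊥-elim (<-irrefl same (count-strict p⊆q xs x∈ px qx))
  where
  p⊆q : p ⊆ᵇ q
  p⊆q y py with q y in qy
  ... | true  = refl
  ... | false = ⊥-elim (cross y x py qy qx px)

∈-─ : ∀ {Y : Set} {y z : Y} (M : List Y) (y∈M : y ∈ M) → z ∈ M → z ≢ y → z ∈ (M ─ y∈M)
∈-─ (_ ∷ M) (here refl) (here refl) z≢y = ⊥-elim (z≢y refl)
∈-─ (_ ∷ M) (here _)    (there z∈M) _   = z∈M
∈-─ (_ ∷ M) (there _)   (here refl) _   = here refl
∈-─ (_ ∷ M) (there y∈M) (there z∈M) z≢y = there (∈-─ M y∈M z∈M z≢y)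

count-injective : ∀ {X Y : Set} (p : X → Bool) (f : X → Y) xs (M : List Y) →
  All (λ x → p x ≡ true → f x ∈ M) xs →
  AllPairs (λ x x' → p x ≡ true → p x' ≡ true → f x ≢ f x') xs →
  count p xs ≤ length M
count-injective p f [] M _ _ = z≤n
count-injective p f (x ∷ xs) M (into ∷ intos) (apart ∷ aparts) with p x
... | false = count-injective p f xs M intos aparts
... | true  = begin
  suc (count p xs)        ≤⟨ s≤s (count-injective p f xs (M ─ fx∈M) intos′ aparts) ⟩
  suc (length (M ─ fx∈M)) ≡⟨ length-removeAt′ M (index fx∈M) ⟨
  length M                ∎
  where
  open ≤-Reasoning
  fx∈M : f x ∈ M
  fx∈M = into refl
  intos′ : All (λ x′ → p x′ ≡ true → f x′ ∈ (M ─ fx∈M)) xs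
  intos′ = All.zipWith (λ (into′ , apart′) px′ → ∈-─ M fx∈M (into′ px′) (λ e → apart′ refl px′ (sym e)))
                       (intos , apart)

Apart : {X : Set} {k : ℕ} → (X → X → Set) → (Fin k → X) → (Fin k → X) → Set
Apart {k = k} R f g = Σ (Fin k) λ i → R (f i) (g i)

extensions-apart : ∀ {X : Set} {k} (R : X → X → Set) (extend : X → (Fin k → X) → Fin (suc k) → X) →
  (∀ a f → extend a f Fin.zero ≡ a) → (∀ a f i → extend a f (Fin.suc i) ≡ f i) →
  ∀ {F xs} → AllPairs (Apart R) F → AllPairs R xs →
  AllPairs (Apart R) (concatMap (λ a → map (extend a) F) xs)
extensions-apart R extend at-zero at-suc {F} {xs} F-apart xs-apart =
  AllPairs.concat⁺ (All.map⁺ (All.universal same-head xs)) (AllPairs.map⁺ (AllPairs.map different-heads xs-apart))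
  where
  same-head : ∀ a → AllPairs (Apart R) (map (extend a) F)
  same-head a = AllPairs.map⁺ (AllPairs.map (λ {f} {g} (i , r) →
    Fin.suc i , subst₂ R (sym (at-suc a f i)) (sym (at-suc a g i)) r) F-apart)
  different-heads : ∀ {a b} → R a b → All (λ f → All (Apart R f) (map (extend b) F)) (map (extend a) F)
  different-heads {a} {b} r = All.map⁺ (All.universal (λ f → All.map⁺ (All.universal (λ g →
    Fin.zero , subst₂ R (sym (at-zero a f)) (sym (at-zero b g)) r) F)) F)

allFuns-apart : ∀ {X : Set} (R : X → X → Set) {xs} → AllPairs R xs → ∀ k → AllPairs (Apart R) (allFuns xs k)
allFuns-apart R xs-apart zero    = [] ∷ []
allFuns-apart R xs-apart (suc k) =
  extensions-apart R _ (λ _ _ → refl) (λ _ _ _ → refl) (allFuns-apart R xs-apart k) xs-apart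

allRels-distinct : ∀ n → AllPairs (Apart (Apart _≢_)) (allRels n)
allRels-distinct n = allFuns-apart _ (allFuns-apart _≢_ bools-distinct n) n
  where
  bools-distinct : AllPairs _≢_ (true ∷ false ∷ [])
  bools-distinct = ((λ ()) ∷ []) ∷ [] ∷ []

sumBelow : ℕ → (ℕ → ℕ) → ℕ
sumBelow zero    f = 0
sumBelow (suc m) f = f m + sumBelow m f

sumBelow-cong : ∀ m {f g : ℕ → ℕ} → (∀ s → f s ≡ g s) → sumBelow m f ≡ sumBelow m g
sumBelow-cong zero    f≡g = refl
sumBelow-cong (suc m) f≡g = cong₂ _+_ (f≡g m) (sumBelow-cong m f≡g)

sumBelow-+ : ∀ m f g → sumBelow m f + sumBelow m g ≡ sumBelow m (λ s → f s + g s)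
sumBelow-+ zero    f g = refl
sumBelow-+ (suc m) f g =
  trans (interchange (f m) (sumBelow m f) (g m) (sumBelow m g)) (cong (f m + g m +_) (sumBelow-+ m f g))

sumBelow-const : ∀ m k → sumBelow m (λ _ → k) ≡ m * k
sumBelow-const zero    k = refl
sumBelow-const (suc m) k = cong (k +_) (sumBelow-const m k)

staircase : (ℕ → ℕ) → ℕ → List (ℕ × ℕ)
staircase w zero    = []
staircase w (suc m) = map (m ,_) (upTo (w m)) ++ staircase w m

staircase-∈ : ∀ w m {s t} → s < m → t < w s → (s , t) ∈ staircase w m
staircase-∈ w (suc m) {s} (s≤s s≤m) t<ws with m≤n⇒m<n∨m≡n s≤m
... | inj₁ s<m  = ∈-++⁺ʳ _ (staircase-∈ w m s<m t<ws)
... | inj₂ refl = ∈-++⁺ˡ (∈-map⁺ (s ,_) (∈-upTo⁺ t<ws))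

length-staircase : ∀ w m → length (staircase w m) ≡ sumBelow m w
length-staircase w zero    = refl
length-staircase w (suc m) = trans (length-++ (map (m ,_) (upTo (w m))))
  (cong₂ _+_ (trans (length-map (m ,_) (upTo (w m))) (length-upTo (w m))) (length-staircase w m))

triangle-step : ∀ k → k + suc (pred k) C 2 ≡ suc k C 2
triangle-step zero    = refl
triangle-step (suc k) = trans (cong (_+ suc k C 2) (sym (nC1≡n (suc k)))) (nCk+nC[k+1]≡[n+1]C[k+1] (suc k) 1)

triangle-sum : ∀ c m → sumBelow m (c ∸_) + suc (c ∸ m) C 2 ≡ suc c C 2
triangle-sum c zero    = refl
triangle-sum c (suc m) = begin
  (c ∸ m) + S + suc (c ∸ suc m) C 2    ≡⟨ cong (λ k → (c ∸ m) + S + suc k C 2) (pred[m∸n]≡m∸[1+n] c m) ⟨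
  (c ∸ m) + S + suc (pred (c ∸ m)) C 2 ≡⟨ trans (cong (_+ K) (+-comm (c ∸ m) S)) (+-assoc S (c ∸ m) K) ⟩
  S + ((c ∸ m) + suc (pred (c ∸ m)) C 2) ≡⟨ cong (S +_) (triangle-step (c ∸ m)) ⟩
  S + suc (c ∸ m) C 2                  ≡⟨ triangle-sum c m ⟩
  suc c C 2                            ∎
  where
  open ≡-Reasoning
  S K : ℕ
  S = sumBelow m (c ∸_)
  K = suc (pred (c ∸ m)) C 2

width : ℕ → ℕ → ℕ → ℕ
width b c s = suc (b ∸ c + s ⊓ c)

width-deficit : ∀ {b c} → c ≤ b → ∀ s → width b c s + (c ∸ s) ≡ suc b
width-deficit {b} {c} c≤b s = cong suc (begin
  b ∸ c + s ⊓ c + (c ∸ s)   ≡⟨ +-assoc (b ∸ c) (s ⊓ c) (c ∸ s) ⟩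
  b ∸ c + (s ⊓ c + (c ∸ s)) ≡⟨ cong (b ∸ c +_) (m⊓n+n∸m≡n s c) ⟩
  b ∸ c + c                 ≡⟨ m∸n+n≡m c≤b ⟩
  b                         ∎)
  where open ≡-Reasoning

staircase-size : ∀ a b c → c ≤ a → c ≤ b →
  length (staircase (width b c) (suc a)) ≡ (a + 1) * (b + 1) ∸ suc c C 2
staircase-size a b c c≤a c≤b = begin
  length (staircase (width b c) (suc a)) ≡⟨ length-staircase (width b c) (suc a) ⟩
  W                                      ≡⟨ m+n∸n≡m W D ⟨
  W + D ∸ D                              ≡⟨ cong₂ _∸_ rows deficit ⟩
  suc a * suc b ∸ suc c C 2              ≡⟨ cong (_∸ suc c C 2) (cong₂ _*_ (+-comm 1 a) (+-comm 1 b)) ⟩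
  (a + 1) * (b + 1) ∸ suc c C 2          ∎
  where
  open ≡-Reasoning
  W D : ℕ
  W = sumBelow (suc a) (width b c)
  D = sumBelow (suc a) (c ∸_)
  rows : W + D ≡ suc a * suc b
  rows = trans (sumBelow-+ (suc a) (width b c) (c ∸_))
               (trans (sumBelow-cong (suc a) (width-deficit c≤b)) (sumBelow-const (suc a) (suc b)))
  deficit : D ≡ suc c C 2
  deficit = trans (sym (+-identityʳ D))
                  (subst (λ k → D + suc k C 2 ≡ suc c C 2) (m≤n⇒m∸n≡0 (m≤n⇒m≤1+n c≤a)) (triangle-sum c (suc a)))

module FixedInside {n : ℕ} (G : Graph n) (A B : VSet n) (u v : Fin n)
  (A-clique : isClique G A)
  (u∈B : B u ≡ true) (v∈B : B v ≡ true) (B⊆uv : ∀ x → B x ≡ true → x ≡ u ⊎ x ≡ v)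
  (u∉A : A u ≡ false) (v∉A : A v ≡ false)
  (T : Rel n) (T∈𝒟 : inD (insideEdges G A B) T ≡ true) (u→v : T u v ≡ true) where

  E : Rel n
  E = betweenEdges G A B

  Good : Rel n → Bool
  Good S = inD E S ∧ compatible S T

  module _ {S : Rel n} (good : Good S ≡ true) where
    private
      S-orients : isOrientation E S ≡ true
      S-orients = proj₁ (∧-true _ (proj₁ (∧-true (inD E S) good)))

    S-reverse : ∀ {x y} → E x y ≡ true → S y x ≡ not (S x y)
    S-reverse = reverse-arc E S S-orients

    S-only-on-edges : ∀ {x y} → E x y ≡ false → S x y ≡ false
    S-only-on-edges {x} {y} no-edge with S x y in xy
    ... | false = refl
    ... | true with () ← trans (sym (arc-on-edge E S S-orients xy)) no-edge

    no-mixed-triangle : ∀ {w x y} → S w x ≡ true → T x y ≡ true → S y w ≡ true → ⊥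
    no-mixed-triangle {w} {x} {y} wx xy yw =
      k3free-acyclic (union S T) (proj₂ (∧-true (inD E S) good)) w x y
        (∨-trueˡ (T w x) wx) (∨-trueʳ (S x y) xy) (∨-trueˡ (T y w) yw)

  between-edge : ∀ {w z} → B w ≡ true → A w ≡ false → A z ≡ true → adj G w z ≡ true → E w z ≡ true
  between-edge w∈B w∉A z∈A wz rewrite wz | w∉A | w∈B | z∈A = refl

  T-reverse-in-A : ∀ {x y} → A x ≡ true → A y ≡ true → x ≢ y → T y x ≡ not (T x y)
  T-reverse-in-A {x} {y} x∈A y∈A x≢y =
    reverse-arc (insideEdges G A B) T (proj₁ (∧-true _ T∈𝒟)) inside-edge
    where
    inside-edge : insideEdges G A B x y ≡ true
    inside-edge rewrite A-clique x y x∈A y∈A x≢y | x∈A | y∈A = refl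

  out : Fin n → Rel n → Fin n → Bool
  out w S z = A z ∧ adj G w z ∧ S w z

  outdeg : Fin n → Rel n → ℕ
  outdeg w S = count (out w S) (allFin n)

  out-false : ∀ S {w z} → A z ≡ true → adj G w z ≡ true → out w S z ≡ false → S w z ≡ false
  out-false S z∈A wz h rewrite z∈A | wz = h

  module OutNeighbourhood (w : Fin n) (w∈B : B w ≡ true) (w∉A : A w ≡ false) where

    -- The out-neighbourhoods of w under compatible S⃗, S⃗' are nested: if S⃗
    -- has w → x, w ← y while S⃗' has w ← x, w → y, the arc of T⃗ on the
    -- A-edge xy closes a mixed triangle through w in S⃗ or in S⃗'.
    nested : ∀ {S S'} → Good S ≡ true → Good S' ≡ true → NonCrossing (out w S) (out w S')
    nested {S} {S'} good good' x y x∈S x∉S' y∈S' y∉S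
      with ∧₃-true (A x) (adj G w x) x∈S | ∧₃-true (A y) (adj G w y) y∈S' | T x y in xy
    ... | _ , _ , Swx | y∈A , wy , _ | true  = no-mixed-triangle good Swx xy Syw
      where
      Syw : S y w ≡ true
      Syw = trans (S-reverse good (between-edge w∈B w∉A y∈A wy)) (cong not (out-false S y∈A wy y∉S))
    ... | x∈A , wx , Swx | y∈A , wy , S'wy | false = no-mixed-triangle good' S'wy yx S'xw
      where
      S'xw : S' x w ≡ true
      S'xw = trans (S-reverse good' (between-edge w∈B w∉A x∈A wx)) (cong not (out-false S' x∈A wx x∉S'))
      x≢y : x ≢ y
      x≢y refl with () ← trans (sym Swx) (out-false S y∈A wy y∉S)
      yx : T y x ≡ true
      yx = trans (T-reverse-in-A x∈A y∈A x≢y) (cong not xy)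

    size-determines : ∀ {S S'} → Good S ≡ true → Good S' ≡ true →
      outdeg w S ≡ outdeg w S' → ∀ z → out w S z ≡ out w S' z
    size-determines good good' same z = equal-count-agree (nested good good') (allFin n) same (∈-allFin z)

    arcs-determined : ∀ {S S'} → Good S ≡ true → Good S' ≡ true → (∀ z → out w S z ≡ out w S' z) →
      ∀ {z} → A z ≡ true → adj G w z ≡ true → S w z ≡ S' w z × S z w ≡ S' z w
    arcs-determined {S} {S'} good good' same {z} z∈A wz = forward , (begin
      S z w          ≡⟨ S-reverse good edge ⟩
      not (S w z)    ≡⟨ cong not forward ⟩
      not (S' w z)   ≡⟨ S-reverse good' edge ⟨
      S' z w         ∎)
      where
      open ≡-Reasoning
      edge : E w z ≡ true
      edge = between-edge w∈B w∉A z∈A wz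
      forward : S w z ≡ S' w z
      forward with same z
      ... | agree rewrite z∈A | wz = agree

  module OutU = OutNeighbourhood u u∈B u∉A
  module OutV = OutNeighbourhood v v∈B v∉A

  profile : Rel n → ℕ × ℕ
  profile S = outdeg u S , outdeg v S

  arcs-at-B : ∀ {S S'} → Good S ≡ true → Good S' ≡ true → profile S ≡ profile S' →
    ∀ w → B w ≡ true → ∀ {z} → A z ≡ true → adj G w z ≡ true → S w z ≡ S' w z × S z w ≡ S' z w
  arcs-at-B good good' same w w∈B with B⊆uv w w∈B
  ... | inj₁ refl = OutU.arcs-determined good good' (OutU.size-determines good good' (cong proj₁ same))
  ... | inj₂ refl = OutV.arcs-determined good good' (OutV.size-determines good good' (cong proj₂ same))

  -- Every edge of G[A,B] joins A to u or v, so the profile determines S⃗.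
  profile-determines : ∀ {S S'} → Good S ≡ true → Good S' ≡ true → profile S ≡ profile S' →
    ∀ x y → S x y ≡ S' x y
  profile-determines {S} {S'} good good' same x y with E x y in xy
  ... | false = trans (S-only-on-edges good xy) (sym (S-only-on-edges good' xy))
  ... | true with ∧-true (adj G x y) xy
  ...   | x~y , sides with ∨-true (A x ∧ B y) sides
  ...     | inj₁ xA-yB = let (x∈A , y∈B) = ∧-true (A x) xA-yB
                         in proj₂ (arcs-at-B good good' same y y∈B x∈A (trans (Graph.sym G y x) x~y))
  ...     | inj₂ xB-yA = let (x∈B , y∈A) = ∧-true (B x) xB-yA
                         in proj₁ (arcs-at-B good good' same x x∈B y∈A x~y)

  profile-injective : ∀ {S S'} → Apart (Apart _≢_) S S' → Good S ≡ true → Good S' ≡ true → profile S ≢ profile S'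
  profile-injective (x , y , differ) good good' same = differ (profile-determines good good' same x y)

  a b c : ℕ
  a = degIn G A u
  b = degIn G A v
  c = codegIn G A u v

  -- A common neighbour z ∈ A with v → z also has u → z, else u → v → z → u.
  common-out : ∀ {S z} → Good S ≡ true → out v S z ≡ true → adj G u z ≡ true → S u z ≡ true
  common-out {S} {z} good vz uz with ∧₃-true (A z) (adj G v z) vz | S u z in Suz
  ... | _ , _ , _ | true = refl
  ... | z∈A , _ , Svz | false = ⊥-elim (no-mixed-triangle good Szu u→v Svz)
    where
    Szu : S z u ≡ true
    Szu = trans (S-reverse good (between-edge u∈B u∉A z∈A uz)) (cong not Suz)

  outdeg-u-bound : ∀ S → outdeg u S ≤ a
  outdeg-u-bound S = count-mono u-neighbour (allFin n)
    where
    u-neighbour : out u S ⊆ᵇ (λ z → A z ∧ adj G u z)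
    u-neighbour z h = let (z∈A , uz , _) = ∧₃-true (A z) (adj G u z) h in ∧-intro z∈A uz

  private-neighbours : count (λ z → (A z ∧ adj G v z) ∧ not (adj G u z)) (allFin n) ≡ b ∸ c
  private-neighbours = sym (begin
    b ∸ c          ≡⟨ cong₂ _∸_ (count-split Nv (adj G u) (allFin n)) (sym common) ⟩
    C′ + P′ ∸ C′   ≡⟨ m+n∸m≡n C′ P′ ⟩
    P′             ∎)
    where
    open ≡-Reasoning
    Nv : Fin n → Bool
    Nv z = A z ∧ adj G v z
    C′ P′ : ℕ
    C′ = count (λ z → Nv z ∧ adj G u z) (allFin n)
    P′ = count (λ z → Nv z ∧ not (adj G u z)) (allFin n)
    common : C′ ≡ c
    common = count-cong (λ z → trans (∧-assoc (A z) _ _) (cong (A z ∧_) (∧-comm (adj G v z) _))) (allFin n)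

  outdeg-v-bound : ∀ {S} → Good S ≡ true → outdeg v S ≤ b ∸ c + outdeg u S ⊓ c
  outdeg-v-bound {S} good = begin
    outdeg v S                    ≡⟨ count-split (out v S) (adj G u) (allFin n) ⟩
    count shared (allFin n) + count own (allFin n)
                                  ≤⟨ +-mono-≤ (⊓-glb (count-mono shared⊆out-u (allFin n))
                                                     (count-mono shared⊆common (allFin n)))
                                              (≤-trans (count-mono own⊆private (allFin n))
                                                       (≤-reflexive private-neighbours)) ⟩
    outdeg u S ⊓ c + (b ∸ c)      ≡⟨ +-comm (outdeg u S ⊓ c) (b ∸ c) ⟩
    b ∸ c + outdeg u S ⊓ c        ∎
    where
    open ≤-Reasoning
    shared own : Fin n → Bool
    shared z = out v S z ∧ adj G u z
    own z = out v S z ∧ not (adj G u z)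
    shared⊆out-u : shared ⊆ᵇ out u S
    shared⊆out-u z h =
      let (vz , uz) = ∧-true (out v S z) h ; (z∈A , _ , _) = ∧₃-true (A z) (adj G v z) vz
      in ∧-intro z∈A (∧-intro uz (common-out good vz uz))
    shared⊆common : shared ⊆ᵇ (λ z → A z ∧ adj G u z ∧ adj G v z)
    shared⊆common z h =
      let (vz , uz) = ∧-true (out v S z) h ; (z∈A , v~z , _) = ∧₃-true (A z) (adj G v z) vz
      in ∧-intro z∈A (∧-intro uz v~z)
    own⊆private : own ⊆ᵇ (λ z → (A z ∧ adj G v z) ∧ not (adj G u z))
    own⊆private z h =
      let (vz , not-uz) = ∧-true (out v S z) h ; (z∈A , v~z , _) = ∧₃-true (A z) (adj G v z) vz
      in ∧-intro (∧-intro z∈A v~z) not-uz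

  codeg≤deg-u : c ≤ a
  codeg≤deg-u = count-mono (λ z h → let (z∈A , uz , _) = ∧₃-true (A z) (adj G u z) h in ∧-intro z∈A uz) (allFin n)

  codeg≤deg-v : c ≤ b
  codeg≤deg-v = count-mono (λ z h → let (z∈A , _ , vz) = ∧₃-true (A z) (adj G u z) h in ∧-intro z∈A vz) (allFin n)

  profile-admissible : ∀ {S} → Good S ≡ true → profile S ∈ staircase (width b c) (suc a)
  profile-admissible {S} good = staircase-∈ (width b c) (suc a) (s≤s (outdeg-u-bound S)) (s≤s (outdeg-v-bound good))

  compatible-count : nCompat G A B T ≤ (a + 1) * (b + 1) ∸ suc c C 2
  compatible-count = begin
    nCompat G A B T               ≤⟨ count-injective Good profile (allRels n) admissible
                                       (All.universal (λ _ → profile-admissible) (allRels n))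
                                       (AllPairs.map profile-injective (allRels-distinct n)) ⟩
    length admissible             ≡⟨ staircase-size a b c codeg≤deg-u codeg≤deg-v ⟩
    (a + 1) * (b + 1) ∸ suc c C 2 ∎
    where
    open ≤-Reasoning
    admissible : List (ℕ × ℕ)
    admissible = staircase (width b c) (suc a)

maxList-filter-bound : ∀ {X : Set} (keep : X → Bool) (f : X → ℕ) {N} →
  (∀ x → keep x ≡ true → f x ≤ N) → ∀ xs → maxList (map f (filterB keep xs)) ≤ N
maxList-filter-bound keep f bound []       = z≤n
maxList-filter-bound keep f bound (x ∷ xs) with keep x in kept
... | true  = ⊔-lub (bound x kept) (maxList-filter-bound keep f bound xs)
... | false = maxList-filter-bound keep f bound xs

module _ {n} (u v : Fin n) where
  u∈pair : pair u v u ≡ true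
  u∈pair = ∨-trueˡ (does (u ≟ v)) (dec-true (u ≟ u) refl)

  v∈pair : pair u v v ≡ true
  v∈pair = ∨-trueʳ (does (v ≟ u)) (dec-true (v ≟ v) refl)

  pair-cases : ∀ x → pair u v x ≡ true → x ≡ u ⊎ x ≡ v
  pair-cases x h with ∨-true (does (x ≟ u)) h
  ... | inj₁ is-u = inj₁ (does-true (x ≟ u) is-u)
  ... | inj₂ is-v = inj₂ (does-true (x ≟ v) is-v)

  pair-outside : ∀ {A : VSet n} → (∀ x → A x ≡ true → pair u v x ≡ false) →
    ∀ {w} → pair u v w ≡ true → A w ≡ false
  pair-outside {A} disjoint {w} w∈B with A w in w∈A
  ... | false = refl
  ... | true with () ← trans (sym w∈B) (disjoint w w∈A)

  pair-arc : ∀ {G : Graph n} {A : VSet n} {T : Rel n} → isClique G (pair u v) → u ≢ v →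
    inD (insideEdges G A (pair u v)) T ≡ true → T u v ≡ true ⊎ T v u ≡ true
  pair-arc {G} {A} {T} uv-clique u≢v T∈𝒟 with T u v in u→v
  ... | true  = inj₁ refl
  ... | false = inj₂ (trans (reverse-arc (insideEdges G A (pair u v)) T (proj₁ (∧-true _ T∈𝒟)) uv-edge)
                            (cong not u→v))
    where
    uv-edge : insideEdges G A (pair u v) u v ≡ true
    uv-edge = ∧-intro (uv-clique u v u∈pair v∈pair u≢v) (∨-trueʳ (A u ∧ A v) (∧-intro u∈pair v∈pair))

bound-symmetric : ∀ {n} (G : Graph n) (A : VSet n) u v →
  (degIn G A v + 1) * (degIn G A u + 1) ∸ suc (codegIn G A v u) C 2
    ≡ (degIn G A u + 1) * (degIn G A v + 1) ∸ suc (codegIn G A u v) C 2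
bound-symmetric G A u v = cong₂ _∸_ (*-comm (degIn G A v + 1) (degIn G A u + 1))
  (cong (λ k → suc k C 2) (count-cong (λ z → cong (A z ∧_) (∧-comm (adj G v z) (adj G u z))) (allFin _)))

-- Lemma 2.4.  For each T⃗ ∈ 𝒟(G[A] ∪ G[B]) apply the fixed-T⃗ bound with u and v
-- ordered along the arc of T⃗ on uv, and take the maximum over T⃗.
lemma2p4 : (r n : ℕ) → 3 ≤ r → (G : Graph n) → (A : VSet n) → (u v : Fin n)
    → u ≢ v → size A ≡ r
    → isClique G A → isClique G (pair u v)
    → (∀ x → A x ≡ true → pair u v x ≡ false)
    → codegIn G A u v ≢ 0
    → ext G A (pair u v)
      ≤ (degIn G A u + 1) * (degIn G A v + 1) ∸ (suc (codegIn G A u v) C 2)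
lemma2p4 r n _ G A u v u≢v _ A-clique uv-clique disjoint _ =
  maxList-filter-bound (inD (insideEdges G A B)) (nCompat G A B) bound (allRels n)
  where
  B : VSet n
  B = pair u v
  u∉A : A u ≡ false
  u∉A = pair-outside u v disjoint (u∈pair u v)
  v∉A : A v ≡ false
  v∉A = pair-outside u v disjoint (v∈pair u v)
  bound : ∀ T → inD (insideEdges G A B) T ≡ true →
          nCompat G A B T ≤ (degIn G A u + 1) * (degIn G A v + 1) ∸ suc (codegIn G A u v) C 2
  bound T T∈𝒟 with pair-arc u v {G} {A} uv-clique u≢v T∈𝒟
  ... | inj₁ u→v = FixedInside.compatible-count G A B u v A-clique (u∈pair u v) (v∈pair u v)
                     (pair-cases u v) u∉A v∉A T T∈𝒟 u→v
  ... | inj₂ v→u = subst (nCompat G A B T ≤_) (bound-symmetric G A u v)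
                     (FixedInside.compatible-count G A B v u A-clique (v∈pair u v) (u∈pair u v)
                       (λ x x∈B → swap (pair-cases u v x x∈B)) v∉A u∉A T T∈𝒟 v→u)
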